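{- Let $n\ge 5$, let $A$ be an apartment of the spherical building $\Delta=|\Lambda(\mathbb{F}_2^{n-1})|$ and let $p$ be a vertex of $A$. If the link $\operatorname{lk}(p,A)$ is contained in $|\mathrm{P}_n|$, then $p$ is a vertex of $|\mathrm{P}_n|$. Moreover, this statement is false for $n=4$.
   Context: $\Delta$ is the order complex of the lattice of linear subspaces of $\mathbb{F}_2^{n-1}$: vertices are the proper non-zero subspaces, simplices are chains. An apartment of $\Delta$ is, for a basis $v_1,\ldots,v_{n-1}$, the subcomplex of chains of subspaces spanned by proper non-empty subsets of the basis. $\operatorname{lk}(p,A)$ is the set of simplices $\sigma\in A$ with $p\notin\sigma$ and $\sigma\cup\{p\}\in A$. Let $e_1,\ldots,e_{n-1}$ be the standard basis and $e_n:=0$; for a set partition $\pi$ of $\{1,\ldots,n\}$ let $f(\pi)=\operatorname{span}\{e_i+e_j:i,j\text{ in a common block}\}$. $|\mathrm{P}_n|$ is the subcomplex of $\Delta$ consisting of chains of proper non-zero subspaces of the form $f(\pi)$. -}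

module Defs where

open import Data.Nat using (ℕ; zero; suc; _≡ᵇ_)
open import Data.Bool using (Bool; true; false; _xor_; if_then_else_)
open import Data.Fin using (Fin; toℕ) renaming (zero to fzero; suc to fsuc)
open import Data.Vec using (Vec; zipWith; replicate; tabulate)
open import Data.Product using (Σ; ∃; _×_; _,_)
open import Data.Sum using (_⊎_)
open import Data.Unit using (⊤)
import Data.Unit.Polymorphic as Poly
open import Data.List using (List; _∷_)
open import Data.List.Relation.Unary.All using (All)
open import Data.List.Relation.Unary.AllPairs using (AllPairs)
open import Relation.Nullary using (¬_)
open import Relation.Binary.PropositionalEquality using (_≡_; _≢_)

-- The vector space F₂^m (here m = n - 1)

V : ℕ → Set
V m = Vec Bool m

0V : ∀ {m} → V m
0V = replicate _ false

_⊕_ : ∀ {m} → V m → V m → V m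
_⊕_ = zipWith _xor_

lincomb : ∀ {m k} → (Fin k → Bool) → (Fin k → V m) → V m
lincomb {k = zero}  K w = 0V
lincomb {k = suc k} K w =
  (if K fzero then w fzero else 0V) ⊕ lincomb (λ i → K (fsuc i)) (λ i → w (fsuc i))

data Span {m : ℕ} {I : Set} (P : I → Set) (w : I → V m) : V m → Set where
  span-0   : Span P w 0V
  span-add : ∀ {x} (i : I) → P i → Span P w x → Span P w (w i ⊕ x)

LinIndep : ∀ {m} → (Fin m → V m) → Set
LinIndep {m} v = (K : Fin m → Bool) → lincomb K v ≡ 0V → ∀ i → K i ≡ false

IsBasis : ∀ {m} → (Fin m → V m) → Set
IsBasis v = LinIndep v × (∀ x → Span (λ _ → ⊤) v x)

Sub : ℕ → Set₁
Sub m = V m → Set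

_⊑_ : ∀ {m} → Sub m → Sub m → Set
S ⊑ T = ∀ x → S x → T x

_≐_ : ∀ {m} → Sub m → Sub m → Set
S ≐ T = (S ⊑ T) × (T ⊑ S)

Comparable : ∀ {m} → Sub m → Sub m → Set
Comparable S T = (S ⊑ T) ⊎ (T ⊑ S)

ProperNonzero : ∀ {m} → Sub m → Set
ProperNonzero S = (∃ λ x → S x × x ≢ 0V) × (∃ λ x → ¬ S x)

-- Apartment determined by a basis v₁,…,v_m

spanOf : ∀ {m} → (Fin m → V m) → (Fin m → Bool) → Sub m
spanOf v J = Span (λ j → J j ≡ true) v

IsVertexA : ∀ {m} → (Fin m → V m) → Sub m → Set
IsVertexA {m} v p =
  Σ (Fin m → Bool) λ J → (∃ λ j → J j ≡ true) × (∃ λ j → J j ≡ false) × (p ≐ spanOf v J)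

-- simplex of the apartment: a (finite) chain of vertices of A
InA : ∀ {m} → (Fin m → V m) → List (Sub m) → Set₁
InA v σ = All (IsVertexA v) σ × AllPairs Comparable σ

InLink : ∀ {m} → (Fin m → V m) → Sub m → List (Sub m) → Set₁
InLink v p σ = InA v σ × All (λ q → ¬ (q ≐ p)) σ × InA v (p ∷ σ)

-- e_i for i ∈ {1..n} (as Fin (suc m)); e_n = 0
e : ∀ {m} → Fin (suc m) → V m
e i = tabulate (λ k → toℕ k ≡ᵇ toℕ i)

-- a set partition of {1..n} given by a block labelling b:
-- i, j lie in a common block iff b i ≡ b j (every partition arises so)
Partition : ℕ → Set
Partition n = Fin n → Fin n

f : ∀ {m} → Partition (suc m) → Sub m
f {m} b = Span {I = Fin (suc m) × Fin (suc m)}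
               (λ { (i , j) → b i ≡ b j })
               (λ { (i , j) → e i ⊕ e j })

IsPVertex : ∀ {m} → Sub m → Set
IsPVertex {m} S = ProperNonzero S × Σ (Partition (suc m)) (λ π → S ≐ f π)

InP : ∀ {m} → List (Sub m) → Set₁
InP σ = All IsPVertex σ × AllPairs Comparable σ

Claim : ℕ → Set₁
Claim m = (v : Fin m → V m) → IsBasis v →
          (p : Sub m) → IsVertexA v p →
          (∀ σ → InLink v p σ → InP σ) →
          IsPVertex p

ClaimN : ℕ → Set₁
ClaimN zero    = Poly.⊤
ClaimN (suc m) = Claim m

module Submission where

-- The spaces f π are exactly the spans of
-- "graphic" vectors e_i + e_j, i.e. of vectors of Hamming weight ≤ 2 (span-graphic).
--   * If |J| ≥ 2, every line ⟨v_j⟩ with j ∈ J is a vertex of the link below p, hence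
--     of the form f π, which forces v_j to be graphic (line-graphic).
--   * If J = {j₁} and w = v_{j₁} is not graphic, then for each k ≠ j₁ the plane
--     ⟨w, v_k⟩ is a vertex of the link above p, hence of the form f π, which forces
--     v_k and w + v_k to be graphic (plane-splitting).  For m ≥ 4 there are three such
--     k, and then w, v_{k₁}, v_{k₂}, v_{k₃} are linearly dependent (dependency): the
--     weight bounds confine the columns of these vectors to finitely many patterns,
--     each admitting a vanishing combination found by exhaustive search.
-- So p is spanned by graphic vectors and is a vertex of |P_n|.  For n = 4 the basis
-- 111, 110, 100 with p = ⟨111⟩ is a counterexample: the only neighbours of p are the
-- planes ⟨111, 110⟩ and ⟨111, 100⟩, both of the form f π, while 111 has weight 3.

open import Defs
open import Data.Nat using (ℕ; zero; suc; _+_; _≤_; _≤?_; _≤ᵇ_; _≡ᵇ_; z≤n; s≤s)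
open import Data.Nat.Properties
  using (≤-trans; ≤-reflexive; +-mono-≤; +-monoˡ-≤; +-monoʳ-≤; n≤1+n; m≤n+m; +-suc; +-comm; +-assoc; ≰⇒>; <-irrefl; m+n≡0⇒m≡0; m+n≡0⇒n≡0; ≤⇒≤ᵇ; ≡ᵇ⇒≡; module ≤-Reasoning)
open import Data.Bool using (Bool; true; false; _xor_; _∧_; _∨_; not; if_then_else_; T)
open import Data.Bool.Properties
  using (xor-assoc; xor-comm; xor-identityˡ; xor-identityʳ; xor-same; ∧-zeroʳ; ∧-identityʳ; ∨-zeroʳ; T-∧)
import Data.Bool.Properties as Bool
open import Data.Fin using (Fin) renaming (zero to fzero; suc to fsuc)
open import Data.Fin.Properties using (_≟_; any?)
open import Data.Fin.Subset.Properties using (anySubset?)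
open import Data.Vec using (Vec; []; _∷_; lookup; replicate; tabulate; _[_]≔_)
open import Data.Vec.Properties
  using (zipWith-assoc; zipWith-comm; zipWith-identityˡ; zipWith-identityʳ; ≡-dec; lookup∘update; lookup∘update′)
open import Data.List using ([]; _∷_)
import Data.List.Relation.Unary.All as All
open import Data.List.Relation.Unary.All using (All; []; _∷_)
open import Data.List.Relation.Unary.AllPairs using (AllPairs; []; _∷_)
open import Data.Product using (Σ; ∃; _×_; _,_; proj₁; proj₂)
open import Data.Sum using (_⊎_; inj₁; inj₂)
open import Data.Unit using (⊤; tt)
open import Data.Empty using (⊥; ⊥-elim)
open import Function.Bundles using (Equivalence)
open import Relation.Nullary using (¬_; Dec; yes; no; does; contradiction)
open import Relation.Nullary.Decidable
  using (dec-true; dec-false; decidable-stable; T?; ¬?; _→-dec_; _×-dec_; from-no)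
open import Relation.Binary.PropositionalEquality

⊕-assoc : ∀ {m} (x y z : V m) → (x ⊕ y) ⊕ z ≡ x ⊕ (y ⊕ z)
⊕-assoc = zipWith-assoc xor-assoc

⊕-comm : ∀ {m} (x y : V m) → x ⊕ y ≡ y ⊕ x
⊕-comm = zipWith-comm xor-comm

⊕-identityˡ : ∀ {m} (x : V m) → 0V ⊕ x ≡ x
⊕-identityˡ = zipWith-identityˡ xor-identityˡ

⊕-identityʳ : ∀ {m} (x : V m) → x ⊕ 0V ≡ x
⊕-identityʳ = zipWith-identityʳ xor-identityʳ

⊕-self : ∀ {m} (x : V m) → x ⊕ x ≡ 0V
⊕-self []      = refl
⊕-self (a ∷ x) = cong₂ _∷_ (xor-same a) (⊕-self x)

⊕-cancelˡ : ∀ {m} (x y : V m) → x ⊕ (x ⊕ y) ≡ y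
⊕-cancelˡ x y = begin
  x ⊕ (x ⊕ y)  ≡⟨ ⊕-assoc x x y ⟨
  (x ⊕ x) ⊕ y  ≡⟨ cong (_⊕ y) (⊕-self x) ⟩
  0V ⊕ y       ≡⟨ ⊕-identityˡ y ⟩
  y            ∎
  where open ≡-Reasoning

⊕-telescope : ∀ {m} (x y z : V m) → (x ⊕ y) ⊕ (y ⊕ z) ≡ x ⊕ z
⊕-telescope x y z = trans (⊕-assoc x y (y ⊕ z)) (cong (x ⊕_) (⊕-cancelˡ y z))

⊕-telescope₃ : ∀ {m} (x y z t : V m) → (x ⊕ y) ⊕ ((y ⊕ z) ⊕ (z ⊕ t)) ≡ x ⊕ t
⊕-telescope₃ x y z t = trans (cong ((x ⊕ y) ⊕_) (⊕-telescope y z t)) (⊕-telescope x y t)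

⊕-interchange : ∀ {m} (a b c d : V m) → (a ⊕ b) ⊕ (c ⊕ d) ≡ (a ⊕ c) ⊕ (b ⊕ d)
⊕-interchange a b c d = begin
  (a ⊕ b) ⊕ (c ⊕ d)  ≡⟨ ⊕-assoc a b (c ⊕ d) ⟩
  a ⊕ (b ⊕ (c ⊕ d))  ≡⟨ cong (a ⊕_) (⊕-assoc b c d) ⟨
  a ⊕ ((b ⊕ c) ⊕ d)  ≡⟨ cong (λ t → a ⊕ (t ⊕ d)) (⊕-comm b c) ⟩
  a ⊕ ((c ⊕ b) ⊕ d)  ≡⟨ cong (a ⊕_) (⊕-assoc c b d) ⟩
  a ⊕ (c ⊕ (b ⊕ d))  ≡⟨ ⊕-assoc a c (b ⊕ d) ⟨
  (a ⊕ c) ⊕ (b ⊕ d)  ∎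
  where open ≡-Reasoning

infix 25 _·_
_·_ : ∀ {m} → Bool → V m → V m
b · x = if b then x else 0V

·-xor : ∀ {m} a b (x : V m) → (a xor b) · x ≡ a · x ⊕ b · x
·-xor true  true  x = sym (⊕-self x)
·-xor true  false x = sym (⊕-identityʳ x)
·-xor false b     x = sym (⊕-identityˡ (b · x))

record IsSubspace {m} (S : Sub m) : Set where
  field
    0∈ : S 0V
    ⊕∈ : ∀ {x y} → S x → S y → S (x ⊕ y)

module _ {m : ℕ} {I : Set} {P : I → Set} {w : I → V m} where

  span-⊕ : ∀ {x y} → Span P w x → Span P w y → Span P w (x ⊕ y)
  span-⊕ {y = y} span-0 t = subst (Span P w) (sym (⊕-identityˡ y)) t
  span-⊕ {y = y} (span-add {x} i p s) t =
    subst (Span P w) (sym (⊕-assoc (w i) x y)) (span-add i p (span-⊕ s t))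

  span-subspace : IsSubspace (Span P w)
  span-subspace = record { 0∈ = span-0 ; ⊕∈ = span-⊕ }

  span-gen : ∀ i → P i → Span P w (w i)
  span-gen i p = subst (Span P w) (⊕-identityʳ (w i)) (span-add i p span-0)

  span-least : ∀ {S} → IsSubspace S → (∀ i → P i → S (w i)) → Span P w ⊑ S
  span-least S-sub gen _ span-0 = IsSubspace.0∈ S-sub
  span-least S-sub gen _ (span-add i p s) = IsSubspace.⊕∈ S-sub (gen i p) (span-least S-sub gen _ s)

  span-nonzeroGen : ∀ x → Span P w x → x ≢ 0V → Σ I λ i → P i × w i ≢ 0V
  span-nonzeroGen .0V span-0 x≢0 = ⊥-elim (x≢0 refl)
  span-nonzeroGen _ (span-add {x} i p s) wi⊕x≢0 with ≡-dec Bool._≟_ (w i) 0V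
  ... | no wi≢0 = i , p , wi≢0
  ... | yes wi≡0 = span-nonzeroGen x s λ x≡0 →
        wi⊕x≢0 (trans (cong₂ _⊕_ wi≡0 x≡0) (⊕-self 0V))

span-mono : ∀ {m} {I : Set} {P Q : I → Set} {w : I → V m} →
            (∀ i → P i → Q i) → Span P w ⊑ Span Q w
span-mono PQ = span-least span-subspace (λ i p → span-gen i (PQ i p))

≐-refl : ∀ {m} {S : Sub m} → S ≐ S
≐-refl = (λ _ s → s) , (λ _ s → s)

≐-trans : ∀ {m} {S T U : Sub m} → S ≐ T → T ≐ U → S ≐ U
≐-trans (S⊑T , T⊑S) (T⊑U , U⊑T) = (λ x s → T⊑U x (S⊑T x s)) , (λ x u → T⊑S x (U⊑T x u))

span-≐ : ∀ {m} {I I' : Set} {P : I → Set} {Q : I' → Set} {w : I → V m} {w' : I' → V m} →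
         (∀ i → P i → Span Q w' (w i)) → (∀ j → Q j → Span P w (w' j)) → Span P w ≐ Span Q w'
span-≐ w⊑ w'⊑ = span-least span-subspace w⊑ , span-least span-subspace w'⊑

Line : ∀ {m} → V m → Sub m
Line u x = (x ≡ 0V) ⊎ (x ≡ u)

line-subspace : ∀ {m} (u : V m) → IsSubspace (Line u)
line-subspace u = record { 0∈ = inj₁ refl ; ⊕∈ = closed }
  where
  closed : ∀ {x y} → Line u x → Line u y → Line u (x ⊕ y)
  closed (inj₁ refl) (inj₁ refl) = inj₁ (⊕-self 0V)
  closed (inj₁ refl) (inj₂ refl) = inj₂ (⊕-identityˡ u)
  closed (inj₂ refl) (inj₁ refl) = inj₂ (⊕-identityʳ u)
  closed (inj₂ refl) (inj₂ refl) = inj₁ (⊕-self u)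

Plane : ∀ {m} → V m → V m → Sub m
Plane w u x = Σ Bool λ a → Σ Bool λ b → x ≡ a · w ⊕ b · u

plane-subspace : ∀ {m} (w u : V m) → IsSubspace (Plane w u)
plane-subspace w u = record
  { 0∈ = false , false , sym (⊕-self 0V)
  ; ⊕∈ = λ { (a , b , refl) (c , d , refl) → a xor c , b xor d , sym (sum a b c d) } }
  where
  sum : ∀ a b c d → (a xor c) · w ⊕ (b xor d) · u ≡ (a · w ⊕ b · u) ⊕ (c · w ⊕ d · u)
  sum a b c d = trans (cong₂ _⊕_ (·-xor a c w) (·-xor b d u)) (⊕-interchange _ _ _ _)

δ : ∀ {k} → Fin k → Fin k → Bool
δ j i = does (i ≟ j)

δ-self : ∀ {k} (j : Fin k) → δ j j ≡ true
δ-self j = dec-true (j ≟ j) refl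

δ-other : ∀ {k} {i j : Fin k} → i ≢ j → δ j i ≡ false
δ-other {i = i} {j} i≢j = dec-false (i ≟ j) i≢j

δ-true : ∀ {k} {i j : Fin k} → δ j i ≡ true → i ≡ j
δ-true {i = i} {j} δ≡true with i ≟ j
... | yes i≡j = i≡j

lincomb-zero : ∀ {m k} (w : Fin k → V m) → lincomb (λ _ → false) w ≡ 0V
lincomb-zero {k = zero}  w = refl
lincomb-zero {k = suc k} w = trans (⊕-identityˡ _) (lincomb-zero (λ i → w (fsuc i)))

lincomb-xor : ∀ {m k} (A B : Fin k → Bool) (w : Fin k → V m) →
              lincomb (λ i → A i xor B i) w ≡ lincomb A w ⊕ lincomb B w
lincomb-xor {k = zero}  A B w = sym (⊕-self 0V)
lincomb-xor {k = suc k} A B w =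
  trans (cong₂ _⊕_ (·-xor (A fzero) (B fzero) (w fzero))
                   (lincomb-xor (λ i → A (fsuc i)) (λ i → B (fsuc i)) (λ i → w (fsuc i))))
        (⊕-interchange _ _ _ _)

lincomb-δ : ∀ {m k} (j : Fin k) (w : Fin k → V m) → lincomb (δ j) w ≡ w j
lincomb-δ fzero    w = trans (cong (w fzero ⊕_) (lincomb-zero (λ i → w (fsuc i)))) (⊕-identityʳ (w fzero))
lincomb-δ (fsuc j) w = trans (⊕-identityˡ _) (lincomb-δ j (λ i → w (fsuc i)))

lincomb-scaledδ : ∀ {m k} (b : Bool) (j : Fin k) (w : Fin k → V m) →
                  lincomb (λ i → b ∧ δ j i) w ≡ b · w j
lincomb-scaledδ true  j w = lincomb-δ j w
lincomb-scaledδ false j w = lincomb-zero w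

span⇒lincomb : ∀ {m k} (J : Fin k → Bool) (w : Fin k → V m) x →
               Span (λ j → J j ≡ true) w x →
               Σ (Fin k → Bool) λ K → (∀ i → J i ≡ false → K i ≡ false) × lincomb K w ≡ x
span⇒lincomb J w .0V span-0 = (λ _ → false) , (λ _ _ → refl) , lincomb-zero w
span⇒lincomb J w _ (span-add {x} i Ji s) with span⇒lincomb J w x s
... | K , supported , K≡x =
  (λ i' → δ i i' xor K i') , supported' ,
  trans (lincomb-xor (δ i) K w) (cong₂ _⊕_ (lincomb-δ i w) K≡x)
  where
  supported' : ∀ i' → J i' ≡ false → δ i i' xor K i' ≡ false
  supported' i' Ji'≡false with i' ≟ i
  ... | yes refl = contradiction (trans (sym Ji) Ji'≡false) λ ()
  ... | no  _    = supported i' Ji'≡false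

basis-notInSpan : ∀ {m} (v : Fin m → V m) → LinIndep v → (J : Fin m → Bool) →
                  ∀ k → J k ≡ false → ¬ spanOf v J (v k)
basis-notInSpan v indep J k Jk≡false vk∈ with span⇒lincomb J v (v k) vk∈
... | K , supported , K≡vk =
  contradiction (subst₂ (λ a b → a xor b ≡ false) (δ-self k) (supported k Jk≡false) coefficient) λ ()
  where
  vanishing : lincomb (λ i → δ k i xor K i) v ≡ 0V
  vanishing = trans (lincomb-xor (δ k) K v) (trans (cong₂ _⊕_ (lincomb-δ k v) K≡vk) (⊕-self (v k)))
  coefficient : δ k k xor K k ≡ false
  coefficient = indep _ vanishing k

basis-nonzero : ∀ {m} (v : Fin m → V m) → LinIndep v → ∀ k → v k ≢ 0V
basis-nonzero v indep k vk≡0 =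
  basis-notInSpan v indep (λ _ → false) k refl (subst (spanOf v (λ _ → false)) (sym vk≡0) span-0)

combo : ∀ {m} → Vec Bool 4 → V m → V m → V m → V m → V m
combo (a ∷ b ∷ c ∷ d ∷ []) w x y z = a · w ⊕ (b · x ⊕ (c · y ⊕ d · z))

nonzero₄ : Vec Bool 4 → Bool
nonzero₄ (a ∷ b ∷ c ∷ d ∷ []) = a ∨ b ∨ c ∨ d

basis-independent₄ : ∀ {m} (v : Fin m → V m) → LinIndep v → ∀ {j k₁ k₂ k₃} →
                     AllPairs _≢_ (j ∷ k₁ ∷ k₂ ∷ k₃ ∷ []) → ∀ K →
                     combo K (v j) (v k₁) (v k₂) (v k₃) ≡ 0V → T (nonzero₄ K) → ⊥
basis-independent₄ v indep {j} {k₁} {k₂} {k₃}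
  ((j≢k₁ ∷ j≢k₂ ∷ j≢k₃ ∷ []) ∷ (k₁≢k₂ ∷ k₁≢k₃ ∷ []) ∷ (k₂≢k₃ ∷ []) ∷ [] ∷ [])
  (a ∷ b ∷ c ∷ d ∷ []) vanishes =
  trivial (vanishing-at j coeff-j) (vanishing-at k₁ coeff-k₁)
          (vanishing-at k₂ coeff-k₂) (vanishing-at k₃ coeff-k₃)
  where
  trivial : ∀ {a b c d} → a ≡ false → b ≡ false → c ≡ false → d ≡ false →
            ¬ T (nonzero₄ (a ∷ b ∷ c ∷ d ∷ []))
  trivial refl refl refl refl ()
  C : _ → Bool
  C i = (a ∧ δ j i) xor ((b ∧ δ k₁ i) xor ((c ∧ δ k₂ i) xor (d ∧ δ k₃ i)))
  C-vanishes : lincomb C v ≡ 0V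
  C-vanishes = trans (lincomb-xor (λ i → a ∧ δ j i) _ v)
    (trans (cong₂ _⊕_ (lincomb-scaledδ a j v)
      (trans (lincomb-xor (λ i → b ∧ δ k₁ i) _ v)
        (cong₂ _⊕_ (lincomb-scaledδ b k₁ v)
          (trans (lincomb-xor (λ i → c ∧ δ k₂ i) _ v)
            (cong₂ _⊕_ (lincomb-scaledδ c k₂ v) (lincomb-scaledδ d k₃ v))))))
      vanishes)
  vanishing-at : ∀ i {x} → C i ≡ x → x ≡ false
  vanishing-at i Ci≡x = trans (sym Ci≡x) (indep C C-vanishes i)
  coeff-j : C j ≡ a
  coeff-j rewrite δ-self j | δ-other j≢k₁ | δ-other j≢k₂ | δ-other j≢k₃
                | ∧-identityʳ a | ∧-zeroʳ b | ∧-zeroʳ c | ∧-zeroʳ d = xor-identityʳ a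
  coeff-k₁ : C k₁ ≡ b
  coeff-k₁ rewrite δ-other (≢-sym j≢k₁) | δ-self k₁ | δ-other k₁≢k₂ | δ-other k₁≢k₃
                 | ∧-zeroʳ a | ∧-identityʳ b | ∧-zeroʳ c | ∧-zeroʳ d = xor-identityʳ b
  coeff-k₂ : C k₂ ≡ c
  coeff-k₂ rewrite δ-other (≢-sym j≢k₂) | δ-other (≢-sym k₁≢k₂) | δ-self k₂ | δ-other k₂≢k₃
                 | ∧-zeroʳ a | ∧-zeroʳ b | ∧-identityʳ c | ∧-zeroʳ d = xor-identityʳ c
  coeff-k₃ : C k₃ ≡ d
  coeff-k₃ rewrite δ-other (≢-sym j≢k₃) | δ-other (≢-sym k₁≢k₃) | δ-other (≢-sym k₂≢k₃) | δ-self k₃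
                 | ∧-zeroʳ a | ∧-zeroʳ b | ∧-zeroʳ c | ∧-identityʳ d = refl

spanδ⊑line : ∀ {m k} (w : Fin k → V m) j → Span (λ i → δ j i ≡ true) w ⊑ Line (w j)
spanδ⊑line w j = span-least (line-subspace (w j)) (λ i δ≡true → inj₂ (cong w (δ-true δ≡true)))

spanOf-ext : ∀ {m} (v : Fin m → V m) {J J' : Fin m → Bool} → (∀ i → J i ≡ J' i) → spanOf v J ≐ spanOf v J'
spanOf-ext v J≡J' = span-mono (λ i Ji → trans (sym (J≡J' i)) Ji) , span-mono (λ i J'i → trans (J≡J' i) J'i)

vertex-properNonzero : ∀ {m} (v : Fin m → V m) → LinIndep v → ∀ {q} → IsVertexA v q → ProperNonzero q
vertex-properNonzero v indep (J , (j , Jj) , (k , Jk) , (q⊑ , ⊑q)) =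
  (v j , ⊑q _ (span-gen j Jj) , basis-nonzero v indep j) ,
  (v k , λ vk∈q → basis-notInSpan v indep J k Jk (q⊑ _ vk∈q))

three-others : ∀ {m} (j : Fin (suc (suc (suc (suc m))))) →
               Σ _ λ k₁ → Σ _ λ k₂ → Σ _ λ k₃ → AllPairs _≢_ (j ∷ k₁ ∷ k₂ ∷ k₃ ∷ [])
three-others fzero =
  fsuc fzero , fsuc (fsuc fzero) , fsuc (fsuc (fsuc fzero)) ,
  ((λ ()) ∷ (λ ()) ∷ (λ ()) ∷ []) ∷ ((λ ()) ∷ (λ ()) ∷ []) ∷ ((λ ()) ∷ []) ∷ [] ∷ []
three-others (fsuc fzero) =
  fzero , fsuc (fsuc fzero) , fsuc (fsuc (fsuc fzero)) ,
  ((λ ()) ∷ (λ ()) ∷ (λ ()) ∷ []) ∷ ((λ ()) ∷ (λ ()) ∷ []) ∷ ((λ ()) ∷ []) ∷ [] ∷ []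
three-others (fsuc (fsuc fzero)) =
  fzero , fsuc fzero , fsuc (fsuc (fsuc fzero)) ,
  ((λ ()) ∷ (λ ()) ∷ (λ ()) ∷ []) ∷ ((λ ()) ∷ (λ ()) ∷ []) ∷ ((λ ()) ∷ []) ∷ [] ∷ []
three-others (fsuc (fsuc (fsuc j))) =
  fzero , fsuc fzero , fsuc (fsuc fzero) ,
  ((λ ()) ∷ (λ ()) ∷ (λ ()) ∷ []) ∷ ((λ ()) ∷ (λ ()) ∷ []) ∷ ((λ ()) ∷ []) ∷ [] ∷ []

-- Hamming weight.  The generators e_i + e_j of the spaces f π (with e_n = 0) are
-- exactly the vectors of weight at most 2; we call them graphic.

b2n : Bool → ℕ
b2n true  = 1
b2n false = 0

wt : ∀ {m} → V m → ℕ
wt []      = 0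
wt (a ∷ x) = b2n a + wt x

wt-0V : ∀ m → wt (0V {m}) ≡ 0
wt-0V zero    = refl
wt-0V (suc m) = wt-0V m

wt-⊕ : ∀ {m} (x y : V m) → wt (x ⊕ y) ≤ wt x + wt y
wt-⊕ []          []          = z≤n
wt-⊕ (false ∷ x) (false ∷ y) = wt-⊕ x y
wt-⊕ (true ∷ x)  (false ∷ y) = s≤s (wt-⊕ x y)
wt-⊕ (false ∷ x) (true ∷ y)  rewrite +-suc (wt x) (wt y) = s≤s (wt-⊕ x y)
wt-⊕ (true ∷ x)  (true ∷ y)  =
  ≤-trans (wt-⊕ x y) (≤-trans (n≤1+n _) (s≤s (+-monoʳ-≤ (wt x) (n≤1+n _))))

tabulate-false : ∀ n → tabulate {n = n} (λ _ → false) ≡ 0V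
tabulate-false zero    = refl
tabulate-false (suc n) = cong (false ∷_) (tabulate-false n)

e-zero : ∀ m → e {suc m} fzero ≡ true ∷ 0V
e-zero m = cong (true ∷_) (tabulate-false m)

wt-e : ∀ {m} (a : Fin (suc m)) → wt (e {m} a) ≤ 1
wt-e {zero}  a        = z≤n
wt-e {suc m} fzero    rewrite tabulate-false m | wt-0V m = s≤s z≤n
wt-e {suc m} (fsuc a) = wt-e {m} a

Graphic : ∀ {m} → V m → Set
Graphic {m} x = Σ (Fin (suc m)) λ a → Σ (Fin (suc m)) λ b → x ≡ e a ⊕ e b

graphic⇒wt≤2 : ∀ {m} {x : V m} → Graphic x → wt x ≤ 2
graphic⇒wt≤2 (a , b , refl) = ≤-trans (wt-⊕ (e a) (e b)) (+-mono-≤ (wt-e a) (wt-e b))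

wt≡0⇒0V : ∀ {m} (x : V m) → wt x ≡ 0 → x ≡ 0V
wt≡0⇒0V []          _  = refl
wt≡0⇒0V (false ∷ x) h  = cong (false ∷_) (wt≡0⇒0V x h)

wt≤1⇒e : ∀ {m} (x : V m) → wt x ≤ 1 → Σ (Fin (suc m)) λ c → x ≡ e c
wt≤1⇒e []          _ = fzero , refl
wt≤1⇒e (false ∷ x) h with wt≤1⇒e x h
... | c , x≡ec = fsuc c , cong (false ∷_) x≡ec
wt≤1⇒e {suc m} (true ∷ x) (s≤s h) with wt x in wt-x
wt≤1⇒e {suc m} (true ∷ x) (s≤s z≤n) | zero =
  fzero , trans (cong (true ∷_) (wt≡0⇒0V x wt-x)) (sym (e-zero m))

wt≤2⇒graphic : ∀ {m} (x : V m) → wt x ≤ 2 → Graphic x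
wt≤2⇒graphic []          _ = fzero , fzero , refl
wt≤2⇒graphic (false ∷ x) h with wt≤2⇒graphic x h
... | a , b , x≡ = fsuc a , fsuc b , cong (false ∷_) x≡
wt≤2⇒graphic {suc m} (true ∷ x) (s≤s h) with wt≤1⇒e x h
... | c , x≡ec = fzero , fsuc c ,
  trans (cong (true ∷_) (trans x≡ec (sym (⊕-identityˡ (e c))))) (cong (_⊕ e (fsuc c)) (sym (e-zero m)))

module _ {m : ℕ} (π : Partition (suc m)) where

  f-gen : ∀ i j → π i ≡ π j → f π (e i ⊕ e j)
  f-gen i j πi≡πj = span-gen {P = λ { (i , j) → π i ≡ π j }} (i , j) πi≡πj

  f-least : ∀ {S} → IsSubspace S → (∀ i j → π i ≡ π j → S (e i ⊕ e j)) → f π ⊑ S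
  f-least S-sub gen = span-least S-sub (λ { (i , j) πi≡πj → gen i j πi≡πj })

  line-graphic : ∀ {u} → f π ⊑ Line u → f π u → u ≢ 0V → Graphic u
  line-graphic {u} f⊑line u∈f u≢0 with span-nonzeroGen u u∈f u≢0
  ... | (a , b) , πa≡πb , g≢0 with f⊑line _ (f-gen a b πa≡πb)
  ...   | inj₁ g≡0 = contradiction g≡0 g≢0
  ...   | inj₂ g≡u = a , b , sym g≡u

f-coarsen : ∀ {m} (π π' : Partition (suc m)) → (∀ i j → π i ≡ π j → π' i ≡ π' j) → f π ⊑ f π'
f-coarsen π π' coarser = f-least π span-subspace (λ i j πi≡πj → f-gen π' i j (coarser i j πi≡πj))

merge : ∀ {m} → Partition (suc m) → Fin (suc m) → Fin (suc m) → Partition (suc m)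
merge π a b c = if does (π c ≟ π b) then π a else π c

module _ {m : ℕ} (π : Partition (suc m)) (a b : Fin (suc m)) where

  merge-coarsens : ∀ i j → π i ≡ π j → merge π a b i ≡ merge π a b j
  merge-coarsens i j πi≡πj = cong (λ t → if does (t ≟ π b) then π a else t) πi≡πj

  merge-joins : merge π a b a ≡ merge π a b b
  merge-joins with π a ≟ π b | π b ≟ π b
  ... | _     | no πb≢πb = contradiction refl πb≢πb
  ... | yes _ | yes _    = refl
  ... | no  _ | yes _    = refl

  f-merge-least : ∀ {S} → IsSubspace S → f π ⊑ S → S (e a ⊕ e b) → f (merge π a b) ⊑ S
  f-merge-least {S} S-sub f⊑S ab∈S = f-least (merge π a b) S-sub gen
    where
    open IsSubspace S-sub
    old : ∀ i j → π i ≡ π j → S (e i ⊕ e j)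
    old i j πi≡πj = f⊑S _ (f-gen π i j πi≡πj)
    ba∈S : S (e b ⊕ e a)
    ba∈S = subst S (⊕-comm (e a) (e b)) ab∈S
    -- A generator of the merged partition is either old, or a path i ~ b ~ a ~ j.
    gen : ∀ i j → merge π a b i ≡ merge π a b j → S (e i ⊕ e j)
    gen i j merged with π i ≟ π b | π j ≟ π b
    ... | yes πi≡πb | yes πj≡πb = old i j (trans πi≡πb (sym πj≡πb))
    ... | no  _     | no  _     = old i j merged
    ... | yes πi≡πb | no  _     =
      subst S (⊕-telescope₃ (e i) (e b) (e a) (e j)) (⊕∈ (old i b πi≡πb) (⊕∈ ba∈S (old a j merged)))
    ... | no  _     | yes πj≡πb =
      subst S (⊕-telescope₃ (e i) (e a) (e b) (e j)) (⊕∈ (old i a merged) (⊕∈ ab∈S (old b j (sym πj≡πb))))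

span-tail : ∀ {m k} (J : Fin (suc k) → Bool) (w : Fin (suc k) → V m) →
            Span (λ j → J (fsuc j) ≡ true) (λ i → w (fsuc i)) ⊑ Span (λ j → J j ≡ true) w
span-tail J w = span-least span-subspace (λ i Ji → span-gen (fsuc i) Ji)

-- A span of graphic vectors is of the form f π: add the generators one at a time,
-- merging the two blocks joined by each new generator e_a + e_b.
span-graphic : ∀ {m} k (J : Fin k → Bool) (w : Fin k → V m) →
               (∀ j → J j ≡ true → Graphic (w j)) →
               Σ (Partition (suc m)) λ π → Span (λ j → J j ≡ true) w ≐ f π
span-graphic zero J w _ =
  (λ i → i) , span-least span-subspace (λ ()) ,
  f-least (λ i → i) span-subspace (λ { i .i refl → subst (Span _ w) (sym (⊕-self (e i))) span-0 })
span-graphic (suc k) J w graphic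
  with span-graphic k (λ i → J (fsuc i)) (λ i → w (fsuc i)) (λ i → graphic (fsuc i))
... | π , tail⊑f , f⊑tail with J fzero in J0
...   | false = π , (λ x s → tail⊑f x (whole⊑tail x s)) , (λ x s → span-tail J w x (f⊑tail x s))
  where
  whole⊑tail : Span (λ j → J j ≡ true) w ⊑ Span (λ j → J (fsuc j) ≡ true) (λ i → w (fsuc i))
  whole⊑tail = span-least span-subspace λ
    { fzero    J0≡true → contradiction (trans (sym J0≡true) J0) λ ()
    ; (fsuc i) Ji      → span-gen i Ji }
...   | true with graphic fzero J0
...     | a , b , w0≡ = merge π a b , whole⊑f , f⊑whole
  where
  whole⊑f : Span (λ j → J j ≡ true) w ⊑ f (merge π a b)
  whole⊑f = span-least span-subspace λ
    { fzero    _  → subst (f (merge π a b)) (sym w0≡) (f-gen (merge π a b) a b (merge-joins π a b))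
    ; (fsuc i) Ji → f-coarsen π (merge π a b) (merge-coarsens π a b) _ (tail⊑f _ (span-gen i Ji)) }
  f⊑whole : f (merge π a b) ⊑ Span (λ j → J j ≡ true) w
  f⊑whole = f-merge-least π a b span-subspace (λ x s → span-tail J w x (f⊑tail x s))
                          (subst (Span _ w) w0≡ (span-gen fzero J0))

spanned-by-graphic : ∀ {m k} {S : Sub m} (g : Fin k → V m) → (∀ j → Graphic (g j)) →
                     S ≐ Span (λ _ → true ≡ true) g → Σ (Partition (suc m)) λ π → S ≐ f π
spanned-by-graphic {k = k} g graphic S≐g with span-graphic k (λ _ → true) g (λ j _ → graphic j)
... | π , g≐f = π , ≐-trans S≐g g≐f

Splitting : ∀ {m} → V m → V m → Set
Splitting w x = wt x ≤ 2 × wt (w ⊕ x) ≤ 2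

plane-splitting : ∀ {m} (π : Partition (suc m)) {w u : V m} → ¬ wt w ≤ 2 → u ≢ 0V → w ≢ u →
                  f π ⊑ Plane w u → f π w → Splitting w u
plane-splitting {m} π {w} {u} w-heavy u≢0 w≢u f⊑plane w∈f =
  decidable-stable (wt u ≤? 2) u-light , decidable-stable (wt (w ⊕ u) ≤? 2) sum-light
  where
  w≢0 : w ≢ 0V
  w≢0 w≡0 = w-heavy (subst (λ x → wt x ≤ 2) (sym w≡0) (subst (_≤ 2) (sym (wt-0V m)) z≤n))
  -- A generator of f π lies in the plane and is graphic, so it is not w.
  generator : ∀ i j → π i ≡ π j → let g = e i ⊕ e j in (g ≡ 0V) ⊎ (g ≡ u) ⊎ (g ≡ w ⊕ u)
  generator i j πi≡πj with f⊑plane _ (f-gen π i j πi≡πj)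
  ... | false , false , g≡ = inj₁ (trans g≡ (⊕-self 0V))
  ... | false , true  , g≡ = inj₂ (inj₁ (trans g≡ (⊕-identityˡ u)))
  ... | true  , true  , g≡ = inj₂ (inj₂ g≡)
  ... | true  , false , g≡ =
    contradiction (graphic⇒wt≤2 (i , j , sym (trans g≡ (⊕-identityʳ w)))) w-heavy
  u-light : ¬ ¬ wt u ≤ 2
  u-light u-heavy with f-least π (line-subspace (w ⊕ u)) on-line w w∈f
    where
    on-line : ∀ i j → π i ≡ π j → Line (w ⊕ u) (e i ⊕ e j)
    on-line i j πi≡πj with generator i j πi≡πj
    ... | inj₁ g≡0        = inj₁ g≡0
    ... | inj₂ (inj₂ g≡s) = inj₂ g≡s
    ... | inj₂ (inj₁ g≡u) = contradiction (graphic⇒wt≤2 (i , j , sym g≡u)) u-heavy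
  ... | inj₁ w≡0   = w≢0 w≡0
  ... | inj₂ w≡w⊕u =
    u≢0 (trans (sym (⊕-cancelˡ w u)) (trans (cong (w ⊕_) (sym w≡w⊕u)) (⊕-self w)))
  sum-light : ¬ ¬ wt (w ⊕ u) ≤ 2
  sum-light sum-heavy with f-least π (line-subspace u) on-line w w∈f
    where
    on-line : ∀ i j → π i ≡ π j → Line u (e i ⊕ e j)
    on-line i j πi≡πj with generator i j πi≡πj
    ... | inj₁ g≡0        = inj₁ g≡0
    ... | inj₂ (inj₁ g≡u) = inj₂ g≡u
    ... | inj₂ (inj₂ g≡s) = contradiction (graphic⇒wt≤2 (i , j , sym g≡s)) sum-heavy
  ... | inj₁ w≡0 = w≢0 w≡0
  ... | inj₂ w≡u = w≢u w≡u

_≼_ : ∀ {m} → V m → V m → Set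
[]      ≼ []      = ⊤
(a ∷ x) ≼ (b ∷ w) = (a ≡ true → b ≡ true) × (x ≼ w)

excess : ∀ {m} → V m → V m → ℕ
excess []      []      = 0
excess (b ∷ w) (a ∷ x) = b2n (not b ∧ a) + excess w x

wt-split : ∀ {m} (w x : V m) → wt x + wt (w ⊕ x) ≡ wt w + (excess w x + excess w x)
wt-split []         []         = refl
wt-split (true ∷ w) (true ∷ x) = cong suc (wt-split w x)
wt-split (true ∷ w) (false ∷ x) = trans (+-suc (wt x) _) (cong suc (wt-split w x))
wt-split (false ∷ w) (false ∷ x) = wt-split w x
wt-split (false ∷ w) (true ∷ x) = begin
  suc (wt x + suc (wt (w ⊕ x)))                 ≡⟨ cong suc (+-suc (wt x) _) ⟩
  suc (suc (wt x + wt (w ⊕ x)))                 ≡⟨ cong (λ t → suc (suc t)) (wt-split w x) ⟩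
  suc (suc (wt w + (excess w x + excess w x)))  ≡⟨ cong suc (+-suc (wt w) _) ⟨
  suc (wt w + suc (excess w x + excess w x))    ≡⟨ cong (λ t → suc (wt w + t)) (+-suc (excess w x) _) ⟨
  suc (wt w + (excess w x + suc (excess w x)))  ≡⟨ +-suc (wt w) _ ⟨
  wt w + suc (excess w x + suc (excess w x))    ∎
  where open ≡-Reasoning

excess-zero : ∀ {m} (w x : V m) → excess w x ≡ 0 → x ≼ w
excess-zero []          []          _      = tt
excess-zero (true ∷ w)  (a ∷ x)     e≡0    = (λ _ → refl) , excess-zero w x e≡0
excess-zero (false ∷ w) (false ∷ x) e≡0    = (λ ()) , excess-zero w x e≡0
excess-zero (false ∷ w) (true ∷ x)  ()

containment : ∀ {m} {w x : V m} → ¬ wt w ≤ 2 → Splitting w x → x ≼ w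
containment {w = w} {x} w-heavy (x-light , wx-light) with excess w x in e≡
... | zero  = excess-zero w x e≡
... | suc e = contradiction (≤-trans five≤ (≤-trans (≤-reflexive (sym (wt-split w x))) (+-mono-≤ x-light wx-light)))
                            (<-irrefl refl)
  where
  five≤ : 5 ≤ wt w + (excess w x + excess w x)
  five≤ rewrite e≡ = +-mono-≤ (≰⇒> w-heavy) (+-mono-≤ (s≤s z≤n) (s≤s z≤n))

-- On the support of w the vectors x, y, z are described by
-- their columns (x_t, y_t, z_t) ∈ F₂³, and only the set of column types that occur
-- (the profile, a subset of F₂³ ≅ Fin 8) matters.
-- colType encodes a point (a, b, c) of F₂³ as an element of Fin 8; bits decodes it.
colType : Bool → Bool → Bool → Fin 8
colType false false false = fzero
colType false false true  = fsuc fzero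
colType false true  false = fsuc (fsuc fzero)
colType false true  true  = fsuc (fsuc (fsuc fzero))
colType true  false false = fsuc (fsuc (fsuc (fsuc fzero)))
colType true  false true  = fsuc (fsuc (fsuc (fsuc (fsuc fzero))))
colType true  true  false = fsuc (fsuc (fsuc (fsuc (fsuc (fsuc fzero)))))
colType true  true  true  = fsuc (fsuc (fsuc (fsuc (fsuc (fsuc (fsuc fzero))))))

bits : Fin 8 → Vec Bool 3
bits fzero                                                   = false ∷ false ∷ false ∷ []
bits (fsuc fzero)                                            = false ∷ false ∷ true  ∷ []
bits (fsuc (fsuc fzero))                                     = false ∷ true  ∷ false ∷ []
bits (fsuc (fsuc (fsuc fzero)))                              = false ∷ true  ∷ true  ∷ []
bits (fsuc (fsuc (fsuc (fsuc fzero))))                       = true  ∷ false ∷ false ∷ []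
bits (fsuc (fsuc (fsuc (fsuc (fsuc fzero)))))                = true  ∷ false ∷ true  ∷ []
bits (fsuc (fsuc (fsuc (fsuc (fsuc (fsuc fzero))))))         = true  ∷ true  ∷ false ∷ []
bits (fsuc (fsuc (fsuc (fsuc (fsuc (fsuc (fsuc fzero)))))))  = true  ∷ true  ∷ true  ∷ []

bit : Fin 3 → Fin 8 → Bool
bit i t = lookup (bits t) i

pick : ∀ {A : Set} → Fin 3 → A → A → A → A
pick i x y z = lookup (x ∷ y ∷ z ∷ []) i

pick-cons : ∀ {m} i a b c (x y z : V m) → pick i (a ∷ x) (b ∷ y) (c ∷ z) ≡ pick i a b c ∷ pick i x y z
pick-cons fzero               a b c x y z = refl
pick-cons (fsuc fzero)        a b c x y z = refl
pick-cons (fsuc (fsuc fzero)) a b c x y z = refl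

bits-colType : ∀ a b c → bits (colType a b c) ≡ a ∷ b ∷ c ∷ []
bits-colType false false false = refl
bits-colType false false true  = refl
bits-colType false true  false = refl
bits-colType false true  true  = refl
bits-colType true  false false = refl
bits-colType true  false true  = refl
bits-colType true  true  false = refl
bits-colType true  true  true  = refl

bit-colType : ∀ i a b c → bit i (colType a b c) ≡ pick i a b c
bit-colType i a b c = cong (λ v → lookup v i) (bits-colType a b c)

count : ∀ {k} → (Fin k → Bool) → Vec Bool k → ℕ
count P []      = 0
count P (s ∷ S) = b2n (s ∧ P fzero) + count (λ t → P (fsuc t)) S

count-mark : ∀ {k} (P : Fin k → Bool) S c → count P (S [ c ]≔ true) ≤ count P S + b2n (P c)
count-mark P (s ∷ S) fzero = begin
  b2n (P fzero) + count _ S                              ≤⟨ +-monoʳ-≤ (b2n (P fzero)) (m≤n+m _ (b2n (s ∧ P fzero))) ⟩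
  b2n (P fzero) + (b2n (s ∧ P fzero) + count _ S)        ≡⟨ +-comm (b2n (P fzero)) _ ⟩
  (b2n (s ∧ P fzero) + count _ S) + b2n (P fzero)        ∎
  where open ≤-Reasoning
count-mark P (s ∷ S) (fsuc c) = begin
  b2n (s ∧ P fzero) + count _ (S [ c ]≔ true)            ≤⟨ +-monoʳ-≤ (b2n (s ∧ P fzero)) (count-mark (λ t → P (fsuc t)) S c) ⟩
  b2n (s ∧ P fzero) + (count _ S + b2n (P (fsuc c)))     ≡⟨ +-assoc (b2n (s ∧ P fzero)) _ _ ⟨
  (b2n (s ∧ P fzero) + count _ S) + b2n (P (fsuc c))     ∎
  where open ≤-Reasoning

count-zero : ∀ {k} (P : Fin k → Bool) S → count P S ≡ 0 → ∀ t → lookup S t ≡ true → P t ≡ false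
count-zero P (true ∷ S) c≡0 fzero refl with P fzero | m+n≡0⇒m≡0 (b2n (P fzero)) c≡0
... | false | _  = refl
... | true  | ()
count-zero P (s ∷ S) c≡0 (fsuc t) St =
  count-zero (λ t → P (fsuc t)) S (m+n≡0⇒n≡0 (b2n (s ∧ P fzero)) c≡0) t St

profile : ∀ {m} → V m → V m → V m → V m → Vec Bool 8
profile []          []      []      []      = replicate 8 false
profile (true ∷ w)  (a ∷ x) (b ∷ y) (c ∷ z) = profile w x y z [ colType a b c ]≔ true
profile (false ∷ w) (_ ∷ x) (_ ∷ y) (_ ∷ z) = profile w x y z

profile-ones : ∀ {m} i (w x y z : V m) → count (bit i) (profile w x y z) ≤ wt (pick i x y z)
profile-ones i [] [] [] [] = z≤n
profile-ones i (true ∷ w) (a ∷ x) (b ∷ y) (c ∷ z) rewrite pick-cons i a b c x y z = begin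
  count (bit i) (profile w x y z [ colType a b c ]≔ true)       ≤⟨ count-mark (bit i) (profile w x y z) (colType a b c) ⟩
  count (bit i) (profile w x y z) + b2n (bit i (colType a b c)) ≤⟨ +-monoˡ-≤ _ (profile-ones i w x y z) ⟩
  wt (pick i x y z) + b2n (bit i (colType a b c))               ≡⟨ +-comm (wt (pick i x y z)) _ ⟩
  b2n (bit i (colType a b c)) + wt (pick i x y z)               ≡⟨ cong (λ t → b2n t + _) (bit-colType i a b c) ⟩
  b2n (pick i a b c) + wt (pick i x y z)                        ∎
  where open ≤-Reasoning
profile-ones i (false ∷ w) (a ∷ x) (b ∷ y) (c ∷ z) rewrite pick-cons i a b c x y z =
  ≤-trans (profile-ones i w x y z) (m≤n+m _ _)

profile-zeros : ∀ {m} i (w x y z : V m) → count (λ t → not (bit i t)) (profile w x y z) ≤ wt (w ⊕ pick i x y z)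
profile-zeros i [] [] [] [] = z≤n
profile-zeros i (true ∷ w) (a ∷ x) (b ∷ y) (c ∷ z) rewrite pick-cons i a b c x y z = begin
  count P (profile w x y z [ colType a b c ]≔ true)          ≤⟨ count-mark P (profile w x y z) (colType a b c) ⟩
  count P (profile w x y z) + b2n (P (colType a b c))        ≤⟨ +-monoˡ-≤ _ (profile-zeros i w x y z) ⟩
  wt (w ⊕ pick i x y z) + b2n (P (colType a b c))            ≡⟨ +-comm (wt (w ⊕ pick i x y z)) _ ⟩
  b2n (P (colType a b c)) + wt (w ⊕ pick i x y z)            ≡⟨ cong (λ t → b2n (not t) + _) (bit-colType i a b c) ⟩
  b2n (not (pick i a b c)) + wt (w ⊕ pick i x y z)           ∎
  where
  open ≤-Reasoning
  P : Fin 8 → Bool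
  P t = not (bit i t)
profile-zeros i (false ∷ w) (a ∷ x) (b ∷ y) (c ∷ z) rewrite pick-cons i a b c x y z =
  ≤-trans (profile-zeros i w x y z) (m≤n+m _ _)

balanced : Fin 3 → Vec Bool 8 → Bool
balanced i S = (count (bit i) S ≤ᵇ 2) ∧ (count (λ t → not (bit i t)) S ≤ᵇ 2)

good : Vec Bool 8 → Bool
good S = balanced fzero S ∧ balanced (fsuc fzero) S ∧ balanced (fsuc (fsuc fzero)) S

∧-intro : ∀ {a b} → T a → T b → T (a ∧ b)
∧-intro ta tb = Equivalence.from T-∧ (ta , tb)

profile-good : ∀ {m} {w x y z : V m} → Splitting w x → Splitting w y → Splitting w z →
               T (good (profile w x y z))
profile-good {w = w} {x} {y} {z} sx sy sz =
  ∧-intro (balanced-at fzero sx) (∧-intro (balanced-at (fsuc fzero) sy) (balanced-at (fsuc (fsuc fzero)) sz))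
  where
  balanced-at : ∀ i → Splitting w (pick i x y z) → T (balanced i (profile w x y z))
  balanced-at i (ones , zeros) = ∧-intro (≤⇒≤ᵇ (≤-trans (profile-ones i w x y z) ones))
                                         (≤⇒≤ᵇ (≤-trans (profile-zeros i w x y z) zeros))

columnValue : Vec Bool 4 → Bool → Bool → Bool → Bool → Bool
columnValue (k₀ ∷ k₁ ∷ k₂ ∷ k₃ ∷ []) a b c d = (k₀ ∧ a) xor ((k₁ ∧ b) xor ((k₂ ∧ c) xor (k₃ ∧ d)))

dot : Vec Bool 4 → Fin 8 → Bool
dot K t = value (bits t)
  where
  value : Vec Bool 3 → Bool
  value (b ∷ c ∷ d ∷ []) = columnValue K true b c d

orth : Vec Bool 8 → Vec Bool 4 → Bool
orth S K = nonzero₄ K ∧ (count (dot K) S ≡ᵇ 0)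

-- Exhaustive check over all 2⁸ profiles: every good profile has such a K.
Certified : Vec Bool 8 → Set
Certified S = T (good S) → ∃ λ K → T (orth S K)

certified? : ∀ S → Dec (Certified S)
certified? S = T? (good S) →-dec anySubset? (λ K → T? (orth S K))

certificate : ∀ S → Certified S
certificate S = decidable-stable (certified? S) λ ¬c → from-no (anySubset? (λ S → ¬? (certified? S))) (S , ¬c)

·-cons : ∀ {m} k a (x : V m) → k · (a ∷ x) ≡ (k ∧ a) ∷ k · x
·-cons true  a x = refl
·-cons false a x = refl

combo-cons : ∀ {m} K a b c d (w x y z : V m) →
             combo K (a ∷ w) (b ∷ x) (c ∷ y) (d ∷ z) ≡ columnValue K a b c d ∷ combo K w x y z
combo-cons (k₀ ∷ k₁ ∷ k₂ ∷ k₃ ∷ []) a b c d w x y z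
  rewrite ·-cons k₀ a w | ·-cons k₁ b x | ·-cons k₂ c y | ·-cons k₃ d z = refl

dot-colType : ∀ K b c d → dot K (colType b c d) ≡ columnValue K true b c d
dot-colType K b c d rewrite bits-colType b c d = refl

columnValue-zero : ∀ K → columnValue K false false false false ≡ false
columnValue-zero (k₀ ∷ k₁ ∷ k₂ ∷ k₃ ∷ []) rewrite ∧-zeroʳ k₀ | ∧-zeroʳ k₁ | ∧-zeroʳ k₂ | ∧-zeroʳ k₃ = refl

marked-mono : ∀ {k} (S : Vec Bool k) c t → lookup S t ≡ true → lookup (S [ c ]≔ true) t ≡ true
marked-mono S c t St with t ≟ c
... | yes refl = lookup∘update t S true
... | no  t≢c  = trans (lookup∘update′ t≢c S true) St

combo-vanishes : ∀ {m} K (w x y z : V m) → x ≼ w → y ≼ w → z ≼ w →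
                 (∀ t → lookup (profile w x y z) t ≡ true → dot K t ≡ false) → combo K w x y z ≡ 0V
combo-vanishes K [] [] [] [] _ _ _ _ = empty (combo K [] [] [] [])
  where
  empty : (v : V 0) → v ≡ []
  empty [] = refl
combo-vanishes K (true ∷ w) (b ∷ x) (c ∷ y) (d ∷ z) (_ , x≼) (_ , y≼) (_ , z≼) orthogonal =
  trans (combo-cons K true b c d w x y z)
        (cong₂ _∷_ (trans (sym (dot-colType K b c d)) (orthogonal (colType b c d) (lookup∘update (colType b c d) (profile w x y z) true)))
                   (combo-vanishes K w x y z x≼ y≼ z≼ λ t St → orthogonal t (marked-mono (profile w x y z) (colType b c d) t St)))
combo-vanishes K (false ∷ w) (false ∷ x) (false ∷ y) (false ∷ z) (_ , x≼) (_ , y≼) (_ , z≼) orthogonal =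
  trans (combo-cons K false false false false w x y z)
        (cong₂ _∷_ (columnValue-zero K) (combo-vanishes K w x y z x≼ y≼ z≼ orthogonal))
combo-vanishes K (false ∷ w) (true ∷ x) _ _ (x≼ , _) _ _ _ = contradiction (x≼ refl) λ ()
combo-vanishes K (false ∷ w) (false ∷ x) (true ∷ y) _ _ (y≼ , _) _ _ = contradiction (y≼ refl) λ ()
combo-vanishes K (false ∷ w) (false ∷ x) (false ∷ y) (true ∷ z) _ _ (z≼ , _) _ = contradiction (z≼ refl) λ ()

dependency : ∀ {m} {w x y z : V m} → ¬ wt w ≤ 2 →
             Splitting w x → Splitting w y → Splitting w z →
             ∃ λ K → T (nonzero₄ K) × combo K w x y z ≡ 0V
dependency {w = w} {x} {y} {z} w-heavy sx sy sz =
  K , proj₁ K-orth ,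
  combo-vanishes K w x y z (containment {w = w} w-heavy sx) (containment {w = w} w-heavy sy)
                 (containment {w = w} w-heavy sz)
                 (count-zero (dot K) (profile w x y z) (≡ᵇ⇒≡ _ 0 (proj₂ K-orth)))
  where
  -- The certificate is used through projections: matching on it would make the
  -- type checker evaluate the exhaustive search on an unknown profile.
  found : ∃ λ K → T (orth (profile w x y z) K)
  found = certificate (profile w x y z) (profile-good {w = w} {x} {y} {z} sx sy sz)
  K : Vec Bool 4
  K = proj₁ found
  K-orth : T (nonzero₄ K) × T (count (dot K) (profile w x y z) ≡ᵇ 0)
  K-orth = Equivalence.to T-∧ (proj₂ found)

module LinkInP {m : ℕ} (v : Fin m → V m) (indep : LinIndep v) (p : Sub m) (J : Fin m → Bool)
               (j₁ : Fin m) (Jj₁ : J j₁ ≡ true) (p-vertex : IsVertexA v p) (p≐ : p ≐ spanOf v J)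
               (link⊆P : ∀ σ → InLink v p σ → InP σ) where

  basis-in-p : ∀ i → J i ≡ true → p (v i)
  basis-in-p i Ji = proj₂ p≐ _ (span-gen i Ji)

  basis-notIn-p : ∀ k → J k ≡ false → ¬ p (v k)
  basis-notIn-p k Jk vk∈p = basis-notInSpan v indep J k Jk (proj₁ p≐ _ vk∈p)

  -- A vertex q ≠ p of A comparable with p spans an edge of lk(p, A), so q = f π.
  neighbour-in-P : ∀ q → IsVertexA v q → ¬ (q ≐ p) → Comparable p q →
                   Σ (Partition (suc m)) λ π → q ≐ f π
  neighbour-in-P q q-vertex q≢p comparable
    with link⊆P (q ∷ []) ((q-vertex ∷ [] , [] ∷ []) , (q≢p ∷ []) ,
                          ((p-vertex ∷ q-vertex ∷ []) , ((comparable ∷ []) ∷ [] ∷ [])))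
  ... | (q-in-P ∷ []) , _ = proj₂ q-in-P

  line-graphic-below : ∀ j o → J j ≡ true → J o ≡ true → o ≢ j → Graphic (v j)
  line-graphic-below j o Jj Jo o≢j with neighbour-in-P line line-vertex line≢p (inj₂ line⊑p)
    where
    line = spanOf v (δ j)
    line-vertex : IsVertexA v line
    line-vertex = δ j , (j , δ-self j) , (o , δ-other o≢j) , ≐-refl
    line≢p : ¬ (line ≐ p)
    line≢p (_ , p⊑line) = basis-notInSpan v indep (δ j) o (δ-other o≢j) (p⊑line _ (basis-in-p o Jo))
    line⊑p : line ⊑ p
    line⊑p x s = proj₂ p≐ x (span-mono (λ i δ≡true → subst (λ t → J t ≡ true) (sym (δ-true δ≡true)) Jj) x s)
  ... | π , line⊑f , f⊑line =
    line-graphic π (λ x s → spanδ⊑line v j x (f⊑line x s))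
                   (line⊑f _ (span-gen j (δ-self j))) (basis-nonzero v indep j)

  module Singleton (only : ∀ j → J j ≡ true → j ≡ j₁) (heavy : ¬ wt (v j₁) ≤ 2) where

    plane-splitting-above : ∀ k l → k ≢ j₁ → l ≢ j₁ → l ≢ k → Splitting (v j₁) (v k)
    plane-splitting-above k l k≢j₁ l≢j₁ l≢k with neighbour-in-P plane plane-vertex plane≢p (inj₁ p⊑plane)
      where
      K : Fin m → Bool
      K i = δ j₁ i ∨ δ k i
      plane = spanOf v K
      plane-vertex : IsVertexA v plane
      plane-vertex = K , (j₁ , cong (_∨ δ k j₁) (δ-self j₁)) ,
                     (l , cong₂ _∨_ (δ-other l≢j₁) (δ-other l≢k)) , ≐-refl
      Jk≡false : J k ≡ false
      Jk≡false with J k in Jk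
      ... | false = refl
      ... | true  = contradiction (only k Jk) k≢j₁
      plane≢p : ¬ (plane ≐ p)
      plane≢p (plane⊑p , _) =
        basis-notIn-p k Jk≡false (plane⊑p _ (span-gen k (trans (cong (δ j₁ k ∨_) (δ-self k)) (∨-zeroʳ (δ j₁ k)))))
      p⊑plane : p ⊑ plane
      p⊑plane x s = span-mono (λ i Ji → subst (λ t → K t ≡ true) (sym (only i Ji))
                                            (cong (_∨ δ k j₁) (δ-self j₁))) x (proj₁ p≐ x s)
    ... | π , plane⊑f , f⊑plane = plane-splitting π heavy (basis-nonzero v indep k) w≢u f⊑Plane w∈f
      where
      w≢u : v j₁ ≢ v k
      w≢u w≡u = basis-notInSpan v indep (δ j₁) k (δ-other k≢j₁)
                  (subst (spanOf v (δ j₁)) w≡u (span-gen j₁ (δ-self j₁)))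
      in-Plane : ∀ i → (δ j₁ i ∨ δ k i) ≡ true → Plane (v j₁) (v k) (v i)
      in-Plane i K≡true with i ≟ j₁
      ... | yes refl = true , false , sym (⊕-identityʳ (v j₁))
      ... | no  _    rewrite δ-true {i = i} {k} K≡true = false , true , sym (⊕-identityˡ (v k))
      f⊑Plane : f π ⊑ Plane (v j₁) (v k)
      f⊑Plane x s = span-least (plane-subspace (v j₁) (v k)) in-Plane x (f⊑plane x s)
      w∈f : f π (v j₁)
      w∈f = plane⊑f _ (span-gen j₁ (cong (_∨ δ k j₁) (δ-self j₁)))

    impossible : ∀ {k₁ k₂ k₃} → AllPairs _≢_ (j₁ ∷ k₁ ∷ k₂ ∷ k₃ ∷ []) → ⊥
    impossible {k₁} {k₂} {k₃} distinct@((j≢k₁ ∷ j≢k₂ ∷ j≢k₃ ∷ []) ∷ (k₁≢k₂ ∷ k₁≢k₃ ∷ []) ∷ (k₂≢k₃ ∷ []) ∷ [] ∷ []) =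
      basis-independent₄ v indep distinct (proj₁ D) (proj₂ (proj₂ D)) (proj₁ (proj₂ D))
      where
      D : ∃ λ K → T (nonzero₄ K) × combo K (v j₁) (v k₁) (v k₂) (v k₃) ≡ 0V
      D = dependency heavy (plane-splitting-above _ _ (≢-sym j≢k₁) (≢-sym j≢k₂) (≢-sym k₁≢k₂))
                           (plane-splitting-above _ _ (≢-sym j≢k₂) (≢-sym j≢k₃) (≢-sym k₂≢k₃))
                           (plane-splitting-above _ _ (≢-sym j≢k₃) (≢-sym j≢k₁) k₁≢k₃)

  p-in-P : (Σ _ λ k₁ → Σ _ λ k₂ → Σ _ λ k₃ → AllPairs _≢_ (j₁ ∷ k₁ ∷ k₂ ∷ k₃ ∷ [])) → IsPVertex p
  p-in-P (_ , _ , _ , distinct) with span-graphic m J v basis-graphic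
    where
    basis-graphic : ∀ j → J j ≡ true → Graphic (v j)
    basis-graphic j Jj with any? (λ i → (J i Bool.≟ true) ×-dec ¬? (i ≟ j₁))
    ... | yes (j₂ , Jj₂ , j₂≢j₁) with j ≟ j₁
    ...   | yes refl = line-graphic-below j₁ j₂ Jj₁ Jj₂ j₂≢j₁
    ...   | no  j≢j₁ = line-graphic-below j j₁ Jj Jj₁ (≢-sym j≢j₁)
    basis-graphic j Jj | no none = subst (λ i → Graphic (v i)) (sym (only j Jj)) (wt≤2⇒graphic (v j₁) light)
      where
      only : ∀ i → J i ≡ true → i ≡ j₁
      only i Ji = decidable-stable (i ≟ j₁) λ i≢j₁ → none (i , Ji , i≢j₁)
      light : wt (v j₁) ≤ 2
      light = decidable-stable (wt (v j₁) ≤? 2) λ heavy → Singleton.impossible only heavy distinct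
  ... | π , span≐f = vertex-properNonzero v indep p-vertex , π , ≐-trans p≐ span≐f

positive : ∀ m → Claim (suc (suc (suc (suc m))))
positive m v (indep , _) p p-vertex@(J , (j₁ , Jj₁) , _ , p≐) link⊆P =
  LinkInP.p-in-P v indep p J j₁ Jj₁ p-vertex p≐ link⊆P (three-others j₁)

module Counterexample where

  v : Fin 3 → V 3
  v fzero               = true ∷ true  ∷ true  ∷ []
  v (fsuc fzero)        = true ∷ true  ∷ false ∷ []
  v (fsuc (fsuc fzero)) = true ∷ false ∷ false ∷ []

  v-independent : LinIndep v
  v-independent K vanishes with trivial (K fzero) (K (fsuc fzero)) (K (fsuc (fsuc fzero))) vanishes
    where
    trivial : ∀ a b c → a · v fzero ⊕ (b · v (fsuc fzero) ⊕ (c · v (fsuc (fsuc fzero)) ⊕ 0V)) ≡ 0V →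
              (a ≡ false) × (b ≡ false) × (c ≡ false)
    trivial false false false _ = refl , refl , refl
    trivial true  true  true  ()
    trivial true  true  false ()
    trivial true  false true  ()
    trivial true  false false ()
    trivial false true  true  ()
    trivial false true  false ()
    trivial false false true  ()
  ... | K₀ , K₁ , K₂ = λ { fzero → K₀ ; (fsuc fzero) → K₁ ; (fsuc (fsuc fzero)) → K₂ }

  v-spans : ∀ x → Span (λ _ → ⊤) v x
  v-spans (false ∷ false ∷ false ∷ []) = span-0
  v-spans (true  ∷ true  ∷ true  ∷ []) = span-add fzero tt span-0
  v-spans (true  ∷ true  ∷ false ∷ []) = span-add (fsuc fzero) tt span-0
  v-spans (true  ∷ false ∷ false ∷ []) = span-add (fsuc (fsuc fzero)) tt span-0
  v-spans (false ∷ true  ∷ true  ∷ []) = span-add fzero tt (span-add (fsuc (fsuc fzero)) tt span-0)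
  v-spans (false ∷ false ∷ true  ∷ []) = span-add fzero tt (span-add (fsuc fzero) tt span-0)
  v-spans (false ∷ true  ∷ false ∷ []) = span-add (fsuc fzero) tt (span-add (fsuc (fsuc fzero)) tt span-0)
  v-spans (true  ∷ false ∷ true  ∷ []) =
    span-add fzero tt (span-add (fsuc fzero) tt (span-add (fsuc (fsuc fzero)) tt span-0))

  p : Sub 3
  p = spanOf v (δ fzero)

  p-vertex : IsVertexA v p
  p-vertex = δ fzero , (fzero , refl) , (fsuc fzero , refl) , ≐-refl

  p-notInP : ¬ IsPVertex p
  p-notInP (_ , π , p⊑f , f⊑p) =
    weight-3 (graphic⇒wt≤2 (line-graphic π (λ x s → spanδ⊑line v fzero x (f⊑p x s))
                                           (p⊑f _ (span-gen fzero refl)) (basis-nonzero v v-independent fzero)))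
    where
    weight-3 : ¬ wt (v fzero) ≤ 2
    weight-3 (s≤s (s≤s ()))

  -- The two planes of A through p, ⟨111, 110⟩ and ⟨111, 100⟩, are spanned by the
  -- graphic vectors 110 = e₁+e₂, 001 = e₃+e₄ and 100 = e₁+e₄, 011 = e₂+e₃ respectively.
  J₀₁ J₀₂ : Fin 3 → Bool
  J₀₁ i = δ fzero i ∨ δ (fsuc fzero) i
  J₀₂ i = δ fzero i ∨ δ (fsuc (fsuc fzero)) i

  plane₀₁-in-P : Σ (Partition 4) λ π → spanOf v J₀₁ ≐ f π
  plane₀₁-in-P = spanned-by-graphic g graphic (span-≐
      (λ { fzero _ → span-add fzero refl (span-add (fsuc fzero) refl span-0)
         ; (fsuc fzero) _ → span-add fzero refl span-0 })
      (λ { fzero _ → span-add (fsuc fzero) refl span-0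
         ; (fsuc fzero) _ → span-add fzero refl (span-add (fsuc fzero) refl span-0) }))
    where
    g : Fin 2 → V 3
    g fzero        = true  ∷ true  ∷ false ∷ []
    g (fsuc fzero) = false ∷ false ∷ true  ∷ []
    graphic : ∀ j → Graphic (g j)
    graphic fzero        = fzero , fsuc fzero , refl
    graphic (fsuc fzero) = fsuc (fsuc fzero) , fsuc (fsuc (fsuc fzero)) , refl

  plane₀₂-in-P : Σ (Partition 4) λ π → spanOf v J₀₂ ≐ f π
  plane₀₂-in-P = spanned-by-graphic g graphic (span-≐
      (λ { fzero _ → span-add fzero refl (span-add (fsuc fzero) refl span-0)
         ; (fsuc (fsuc fzero)) _ → span-add fzero refl span-0 })
      (λ { fzero _ → span-add (fsuc (fsuc fzero)) refl span-0
         ; (fsuc fzero) _ → span-add fzero refl (span-add (fsuc (fsuc fzero)) refl span-0) }))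
    where
    g : Fin 2 → V 3
    g fzero        = true  ∷ false ∷ false ∷ []
    g (fsuc fzero) = false ∷ true  ∷ true  ∷ []
    graphic : ∀ j → Graphic (g j)
    graphic fzero        = fzero , fsuc (fsuc (fsuc fzero)) , refl
    graphic (fsuc fzero) = fsuc fzero , fsuc (fsuc fzero) , refl

  neighbour-in-P : ∀ q → IsVertexA v q → ¬ (q ≐ p) → Comparable p q → IsPVertex q
  neighbour-in-P q q-vertex@(J , (j , Jj) , (k , Jk) , q≐) q≢p comparable =
    vertex-properNonzero v v-independent q-vertex , classify comparable
    where
    p⊑q-if : J fzero ≡ true → p ⊑ q
    p⊑q-if J0 x s = proj₂ q≐ x (span-mono (λ i δ≡true → subst (λ t → J t ≡ true) (sym (δ-true δ≡true)) J0) x s)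
    q⊑p-if : (∀ i → J i ≡ true → δ fzero i ≡ true) → q ⊑ p
    q⊑p-if J⊆δ x s = span-mono J⊆δ x (proj₁ q≐ x s)
    classify : Comparable p q → Σ (Partition 4) λ π → q ≐ f π
    -- q ⊑ p forces q = p; if p ⊑ q then J = {0, 1} or J = {0, 2}.
    classify (inj₂ q⊑p) with j ≟ fzero
    ... | yes refl = contradiction (q⊑p , p⊑q-if Jj) q≢p
    ... | no  j≢0  = contradiction (q⊑p _ (proj₂ q≐ _ (span-gen j Jj)))
                                   (basis-notInSpan v v-independent (δ fzero) j (δ-other j≢0))
    classify (inj₁ p⊑q) with J fzero in J0 | J (fsuc fzero) in J1 | J (fsuc (fsuc fzero)) in J2
    ... | false | _     | _     = contradiction (proj₁ q≐ _ (p⊑q _ (span-gen fzero refl)))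
                                              (basis-notInSpan v v-independent J fzero J0)
    ... | true  | false | false = contradiction (q⊑p-if J⊆δ , p⊑q) q≢p
      where
      J⊆δ : ∀ i → J i ≡ true → δ fzero i ≡ true
      J⊆δ fzero               _ = refl
      J⊆δ (fsuc fzero)        J1≡true = contradiction (trans (sym J1) J1≡true) λ ()
      J⊆δ (fsuc (fsuc fzero)) J2≡true = contradiction (trans (sym J2) J2≡true) λ ()
    ... | true  | true  | false = proj₁ plane₀₁-in-P , ≐-trans q≐ (≐-trans (spanOf-ext v J≡) (proj₂ plane₀₁-in-P))
      where
      J≡ : ∀ i → J i ≡ J₀₁ i
      J≡ fzero               = J0
      J≡ (fsuc fzero)        = J1
      J≡ (fsuc (fsuc fzero)) = J2
    ... | true  | false | true  = proj₁ plane₀₂-in-P , ≐-trans q≐ (≐-trans (spanOf-ext v J≡) (proj₂ plane₀₂-in-P))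
      where
      J≡ : ∀ i → J i ≡ J₀₂ i
      J≡ fzero               = J0
      J≡ (fsuc fzero)        = J1
      J≡ (fsuc (fsuc fzero)) = J2
    ... | true  | true  | true  = contradiction (trans (sym Jk) (J-full k)) λ ()
      where
      J-full : ∀ i → J i ≡ true
      J-full fzero               = J0
      J-full (fsuc fzero)        = J1
      J-full (fsuc (fsuc fzero)) = J2

  link-in-P : ∀ σ → InLink v p σ → InP σ
  link-in-P σ ((σ-vertices , σ-chain) , σ≢p , (_ , (p-comparable ∷ _))) =
    All.zipWith (λ { (q-vertex , q≢p , cmp) → neighbour-in-P _ q-vertex q≢p cmp })
                (σ-vertices , All.zip (σ≢p , p-comparable)) ,
    σ-chain

  counterexample : ¬ Claim 3
  counterexample claim = p-notInP (claim v (v-independent , v-spans) p p-vertex link-in-P)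

mainTheorem10 : ((n : ℕ) → 5 ≤ n → ClaimN n) × ¬ ClaimN 4
mainTheorem10 = positive-n , Counterexample.counterexample
  where
  positive-n : (n : ℕ) → 5 ≤ n → ClaimN n
  positive-n (suc (suc (suc (suc (suc m))))) (s≤s (s≤s (s≤s (s≤s (s≤s _))))) = positive m
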